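{- Let $G$ be a graph and $\mathcal{F}=\{F_1,\dots,F_k\}$ a set of $k$ flips in $G$. Then there exists a set of flips $\mathcal{F}'$ with $G\oplus\mathcal{F}=G\oplus\mathcal{F}'$ and $|\mathcal{F}'|\le\binom{2^{2k}+1}{2}$ such that no pair of vertices of $G$ has its adjacency flipped by more than one flip of $\mathcal{F}'$.
   Context: A flip in a graph $G$ is a pair $F=(A,B)$ of subsets of $V(G)$ (possibly intersecting or equal); $G\oplus F$ is the graph on $V(G)$ with edge set $E(G)\,\Delta\,((A\times B)\cup(B\times A))$. A flip $(A,B)$ flips the adjacency of the pair $\{u,v\}$ of distinct vertices if $(u,v)\in (A\times B)\cup(B\times A)$. For a set of flips $\mathcal{F}=\{F_1,\dots,F_k\}$, $G\oplus\mathcal{F}=G\oplus F_1\oplus\cdots\oplus F_k$ (the order is irrelevant). -}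

module Defs where

open import Data.Nat using (ℕ; zero; suc)
open import Data.Bool using (Bool; true; false; _∧_; _∨_; _xor_; if_then_else_)
open import Data.Fin using (Fin)
open import Data.Fin.Subset using (Subset)
open import Data.Vec using (lookup)
open import Data.List using (List; []; _∷_)
open import Data.Product using (_×_; _,_)
open import Relation.Binary.PropositionalEquality using (_≡_)
open import Relation.Nullary using (¬_)

Adj : ℕ → Set
Adj n = Fin n → Fin n → Bool

record IsGraph {n : ℕ} (G : Adj n) : Set where
  field
    symmetric   : ∀ u v → G u v ≡ G v u
    irreflexive : ∀ u → G u u ≡ false

Flip : ℕ → Set
Flip n = Subset n × Subset n

flipsPair : ∀ {n} → Flip n → Fin n → Fin n → Bool
flipsPair (A , B) u v = (lookup A u ∧ lookup B v) ∨ (lookup B u ∧ lookup A v)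

-- G ⊕ F : toggle adjacency of every pair of distinct vertices flipped by F.
-- The diagonal is left unchanged (graphs have no loops).
_⊕_ : ∀ {n} → Adj n → Flip n → Adj n
(G ⊕ F) u v with u Data.Fin.≟ v
... | Relation.Nullary.yes _ = G u v
... | Relation.Nullary.no _ = G u v xor flipsPair F u v

_⊕*_ : ∀ {n} → Adj n → List (Flip n) → Adj n
G ⊕* [] = G
G ⊕* (F ∷ Fs) = (G ⊕ F) ⊕* Fs

countFlipping : ∀ {n} → List (Flip n) → Fin n → Fin n → ℕ
countFlipping [] u v = zero
countFlipping (F ∷ Fs) u v =
  if flipsPair F u v then suc (countFlipping Fs u v) else countFlipping Fs u v

module Submission where

-- The type of a vertex u records, for every flip (A , B) of 𝓕, whether u ∈ A and whether u ∈ B;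
-- there are 4^k types. Whether 𝓕 flips a pair {u , v} an odd number of times depends only on the
-- types of u and v. So 𝓕 can be replaced by the flips (Cₛ , Cₜ), one for each unordered pair {s , t}
-- of types (s = t allowed) of odd parity, where Cₛ is the set of vertices of type s: a pair of
-- distinct vertices u, v is then flipped by the flip indexed by {type u , type v} and by no other.
-- Discarding the flips that flip no pair of distinct vertices makes the flips pairwise distinct,
-- since two equal flips would flip a common pair twice.

open import Defs
open import Data.Bool using (Bool; true; false; _∧_; _∨_; _xor_; not; if_then_else_)
open import Data.Bool.Properties as Bool
  using (∧-comm; ∨-comm; ∨-idem; ∨-identityʳ; ∧-zeroʳ; xor-assoc; xor-identityʳ; ¬-not)
open import Data.Fin as Fin using (Fin)
open import Data.Fin.Properties using (any?)
open import Data.Fin.Subset using (Subset)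
open import Data.List using (List; []; _∷_; length; map; _++_; filter; filterᵇ; cartesianProductWith)
open import Data.List.Properties using (length-++; length-map; length-filter)
open import Data.List.Membership.Propositional using (_∈_)
open import Data.List.Relation.Unary.All as All using (All; []; _∷_)
open import Data.List.Relation.Unary.All.Properties using (all-filter; ++⁺; map⁺)
open import Data.List.Relation.Unary.AllPairs using ([]; _∷_)
open import Data.List.Relation.Unary.Unique.Propositional using (Unique)
open import Data.Nat using (ℕ; zero; suc; _+_; _*_; _^_; _≤_; z≤n; s≤s; s≤s⁻¹)
open import Data.Nat.Combinatorics using (_C_; nC1≡n; nCk+nC[k+1]≡[n+1]C[k+1])
open import Data.Nat.Properties using (module ≤-Reasoning; ≤-trans; ≤-refl; ≤-reflexive; n≤1+n; n≤0⇒n≡0; +-comm; ^-*-assoc)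
open import Data.Product using (Σ; ∃; _×_; _,_; uncurry)
import Data.Product.Properties as Product
open import Data.Sum using (_⊎_; inj₁; inj₂)
open import Data.Vec using (Vec; []; _∷_; lookup; tabulate)
import Data.Vec.Properties as Vec
open import Function using (_∘_)
open import Relation.Binary.Definitions using (DecidableEquality)
open import Relation.Binary.PropositionalEquality
open import Relation.Nullary using (¬_; does; yes; no; ¬?; T?; _×-dec_; contradiction)
open import Relation.Nullary.Decidable using (dec-true)
open import Relation.Unary using (Decidable)

private variable
  A B : Set

∧-∨-reverse : ∀ a b c d → (a ∧ b) ∨ (c ∧ d) ≡ (d ∧ c) ∨ (b ∧ a)
∧-∨-reverse a b c d rewrite ∧-comm a b | ∧-comm c d = ∨-comm (b ∧ a) (d ∧ c)

∧-congˡ-if : ∀ {a a′} b → (b ≡ true → a ≡ a′) → a ∧ b ≡ a′ ∧ b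
∧-congˡ-if {a} {a′} true a≡a′ rewrite a≡a′ refl = refl
∧-congˡ-if {a} {a′} false _ = trans (∧-zeroʳ a) (sym (∧-zeroʳ a′))

odd : ℕ → Bool
odd zero = false
odd (suc n) = not (odd n)

odd-indicator : ∀ b → odd (if b then 1 else 0) ≡ b
odd-indicator true = refl
odd-indicator false = refl

indicator≤1 : ∀ b → (if b then 1 else 0) ≤ 1
indicator≤1 true = s≤s z≤n
indicator≤1 false = z≤n

indicator-+ : ∀ b n → (if b then 1 else 0) + n ≡ (if b then suc n else n)
indicator-+ true n = refl
indicator-+ false n = refl

if-suc-cong : ∀ b {m n} → m ≡ n → (if b then suc m else m) ≡ (if b then suc n else n)
if-suc-cong b refl = refl

count : (A → Bool) → List A → ℕ
count P [] = 0
count P (x ∷ xs) = if P x then suc (count P xs) else count P xs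

count-++ : (P : A → Bool) (xs ys : List A) → count P (xs ++ ys) ≡ count P xs + count P ys
count-++ P [] ys = refl
count-++ P (x ∷ xs) ys with P x
... | true = cong suc (count-++ P xs ys)
... | false = count-++ P xs ys

count-map : (P : B → Bool) (f : A → B) (xs : List A) →
  count P (map f xs) ≡ count (λ x → P (f x)) xs
count-map P f [] = refl
count-map P f (x ∷ xs) = if-suc-cong (P (f x)) (count-map P f xs)

count-filter : {R : A → Set} (R? : Decidable R) (P : A → Bool) (xs : List A) →
  count P (filter R? xs) ≡ count (λ x → does (R? x) ∧ P x) xs
count-filter R? P [] = refl
count-filter R? P (x ∷ xs) with does (R? x)
... | true = if-suc-cong (P x) (count-filter R? P xs)
... | false = count-filter R? P xs

count-cong-All : {P Q : A → Bool} {xs : List A} → All (λ x → P x ≡ Q x) xs → count P xs ≡ count Q xs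
count-cong-All [] = refl
count-cong-All {Q = Q} {x ∷ _} (Px≡Qx ∷ eqs) rewrite Px≡Qx = if-suc-cong (Q x) (count-cong-All eqs)

count-cong : {P Q : A → Bool} → (∀ x → P x ≡ Q x) → (xs : List A) → count P xs ≡ count Q xs
count-cong P≗Q xs = count-cong-All (All.universal P≗Q xs)

count-none : {P : A → Bool} {xs : List A} → All (λ x → P x ≡ false) xs → count P xs ≡ 0
count-none [] = refl
count-none (Px≡false ∷ none) rewrite Px≡false = count-none none

none-if-count≡0 : (P : A → Bool) (xs : List A) → count P xs ≡ 0 → All (λ x → P x ≡ false) xs
none-if-count≡0 P [] _ = []
none-if-count≡0 P (x ∷ xs) with P x in Px
... | false = λ count≡0 → Px ∷ none-if-count≡0 P xs count≡0
... | true = λ ()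

count-∧ˡ : (b : Bool) (P : A → Bool) (xs : List A) →
  count (λ x → b ∧ P x) xs ≡ (if b then count P xs else 0)
count-∧ˡ true P xs = refl
count-∧ˡ false P xs = count-none (All.universal (λ _ → refl) xs)

count-∷-reject : (P : A → Bool) {x : A} (xs : List A) → ¬ P x ≡ true → count P (x ∷ xs) ≡ count P xs
count-∷-reject P xs ¬Px rewrite ¬-not ¬Px = refl

count-≤-∷ : (P : A → Bool) (x : A) (xs : List A) → count P xs ≤ count P (x ∷ xs)
count-≤-∷ P x xs with P x
... | true = n≤1+n _
... | false = ≤-refl

count≤1-∷-none : (P : A → Bool) {x : A} (xs : List A) → P x ≡ true →
  count P (x ∷ xs) ≤ 1 → All (λ y → P y ≡ false) xs
count≤1-∷-none P xs Px≡true atMostOne rewrite Px≡true =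
  none-if-count≡0 P xs (n≤0⇒n≡0 (s≤s⁻¹ atMostOne))

unorderedPairs : List A → List (A × A)
unorderedPairs [] = []
unorderedPairs (x ∷ xs) = map (x ,_) (x ∷ xs) ++ unorderedPairs xs

length-unorderedPairs : (xs : List A) → length (unorderedPairs xs) ≡ suc (length xs) C 2
length-unorderedPairs [] = refl
length-unorderedPairs (x ∷ xs) = begin
    length (map (x ,_) (x ∷ xs) ++ unorderedPairs xs)
  ≡⟨ length-++ (map (x ,_) (x ∷ xs)) ⟩
    length (map (x ,_) (x ∷ xs)) + length (unorderedPairs xs)
  ≡⟨ cong₂ _+_ (length-map (x ,_) (x ∷ xs)) (length-unorderedPairs xs) ⟩
    suc (length xs) + suc (length xs) C 2
  ≡⟨ cong (_+ suc (length xs) C 2) (nC1≡n (suc (length xs))) ⟨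
    suc (length xs) C 1 + suc (length xs) C 2
  ≡⟨ nCk+nC[k+1]≡[n+1]C[k+1] (suc (length xs)) 1 ⟩
    suc (suc (length xs)) C 2 ∎
  where open ≡-Reasoning

count-unorderedPairs-∷ : (P : A × A → Bool) (x : A) (xs : List A) →
  count P (unorderedPairs (x ∷ xs)) ≡ count (λ t → P (x , t)) (x ∷ xs) + count P (unorderedPairs xs)
count-unorderedPairs-∷ P x xs =
  trans (count-++ P (map (x ,_) (x ∷ xs)) (unorderedPairs xs))
        (cong (_+ count P (unorderedPairs xs)) (count-map P (x ,_) (x ∷ xs)))

joins : (A → Bool) → (A → Bool) → A × A → Bool
joins α β (s , t) = (α s ∧ β t) ∨ (α t ∧ β s)

joins-comm : (α β : A → Bool) (p : A × A) → joins α β p ≡ joins β α p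
joins-comm α β (s , t) = ∧-∨-reverse (α s) (β t) (α t) (β s)

joins-none : (α β : A → Bool) (xs : List A) → All (λ x → α x ≡ false) xs →
  All (λ p → joins α β p ≡ false) (unorderedPairs xs)
joins-none α β [] [] = []
joins-none α β (x ∷ xs) (αx ∷ αxs) =
  ++⁺ (map⁺ (All.map joins-false (αx ∷ αxs))) (joins-none α β xs αxs)
  where
    joins-false : ∀ {t} → α t ≡ false → joins α β (x , t) ≡ false
    joins-false αt rewrite αx | αt = refl

count-joins-unorderedPairs-head : (α β : A → Bool) (x : A) (xs : List A) → α x ≡ true →
  All (λ t → α t ≡ false) xs → count β (x ∷ xs) ≡ 1 → count (joins α β) (unorderedPairs (x ∷ xs)) ≡ 1
count-joins-unorderedPairs-head α β x xs αx αxs βonce = begin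
    count (joins α β) (unorderedPairs (x ∷ xs))
  ≡⟨ count-unorderedPairs-∷ (joins α β) x xs ⟩
    count (λ t → joins α β (x , t)) (x ∷ xs) + count (joins α β) (unorderedPairs xs)
  ≡⟨ cong₂ _+_ (count-cong-All (joins-diagonal ∷ All.map joins-tail αxs)) (count-none (joins-none α β xs αxs)) ⟩
    count β (x ∷ xs) + 0
  ≡⟨ cong (_+ 0) βonce ⟩
    1 ∎
  where
    open ≡-Reasoning
    joins-diagonal : joins α β (x , x) ≡ β x
    joins-diagonal rewrite αx = ∨-idem (β x)
    joins-tail : ∀ {t} → α t ≡ false → joins α β (x , t) ≡ β t
    joins-tail {t} αt rewrite αx | αt = ∨-identityʳ (β t)

count-joins-unorderedPairs : (α β : A → Bool) (xs : List A) → count α xs ≡ 1 → count β xs ≡ 1 →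
  count (joins α β) (unorderedPairs xs) ≡ 1
count-joins-unorderedPairs α β [] ()
count-joins-unorderedPairs α β (x ∷ xs) αonce βonce with α x Bool.≟ true | β x Bool.≟ true
... | yes αx | _ = count-joins-unorderedPairs-head α β x xs αx (count≤1-∷-none α xs αx (≤-reflexive αonce)) βonce
... | no ¬αx | yes βx = trans (count-cong (joins-comm α β) (unorderedPairs (x ∷ xs)))
  (count-joins-unorderedPairs-head β α x xs βx (count≤1-∷-none β xs βx (≤-reflexive βonce)) αonce)
... | no ¬αx | no ¬βx = trans (count-unorderedPairs-∷ (joins α β) x xs)
  (cong₂ _+_ (count-none (All.universal joins-false (x ∷ xs)))
             (count-joins-unorderedPairs α β xs (trans (sym (count-∷-reject α xs ¬αx)) αonce)
                                              (trans (sym (count-∷-reject β xs ¬βx)) βonce)))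
  where
    joins-false : ∀ t → joins α β (x , t) ≡ false
    joins-false t rewrite ¬-not ¬αx | ¬-not ¬βx = ∧-zeroʳ (α t)

Enumerates : DecidableEquality A → List A → Set
Enumerates _≟_ xs = ∀ x → count (λ y → does (x ≟ y)) xs ≡ 1

module _ (_≟_ : DecidableEquality A) where

  joins-≟-sound : (x y s t : A) → joins (λ z → does (x ≟ z)) (λ z → does (y ≟ z)) (s , t) ≡ true →
    (x ≡ s × y ≡ t) ⊎ (x ≡ t × y ≡ s)
  joins-≟-sound x y s t with x ≟ s | y ≟ t | x ≟ t | y ≟ s
  ... | yes x≡s | yes y≡t | _       | _       = λ _ → inj₁ (x≡s , y≡t)
  ... | _       | _       | yes x≡t | yes y≡s = λ _ → inj₂ (x≡t , y≡s)
  ... | no _    | _       | no _    | _       = λ ()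
  ... | no _    | _       | yes _   | no _    = λ ()
  ... | yes _   | no _    | no _    | _       = λ ()
  ... | yes _   | no _    | yes _   | no _    = λ ()

  count-cartesianProduct-∷ : {k : ℕ} {ys : List (Vec A k)} → Enumerates (Vec.≡-dec _≟_) ys →
    (a : A) (w : Vec A k) (xs : List A) →
    count (λ v → does (Vec.≡-dec _≟_ (a ∷ w) v)) (cartesianProductWith _∷_ xs ys) ≡ count (λ x → does (a ≟ x)) xs
  count-cartesianProduct-∷ _ a w [] = refl
  count-cartesianProduct-∷ {k} {ys} ys-enum a w (x ∷ xs) = begin
      count P (map (x ∷_) ys ++ cartesianProductWith _∷_ xs ys)
    ≡⟨ count-++ P (map (x ∷_) ys) _ ⟩
      count P (map (x ∷_) ys) + count P (cartesianProductWith _∷_ xs ys)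
    ≡⟨ cong₂ _+_ (count-map P (x ∷_) ys) (count-cartesianProduct-∷ ys-enum a w xs) ⟩
      count (λ y → does (a ≟ x) ∧ does (Vec.≡-dec _≟_ w y)) ys + count (λ z → does (a ≟ z)) xs
    ≡⟨ cong (_+ count (λ z → does (a ≟ z)) xs) (count-∧ˡ (does (a ≟ x)) _ ys) ⟩
      (if does (a ≟ x) then count (λ y → does (Vec.≡-dec _≟_ w y)) ys else 0) + count (λ z → does (a ≟ z)) xs
    ≡⟨ cong (λ c → (if does (a ≟ x) then c else 0) + count (λ z → does (a ≟ z)) xs) (ys-enum w) ⟩
      (if does (a ≟ x) then 1 else 0) + count (λ z → does (a ≟ z)) xs
    ≡⟨ indicator-+ (does (a ≟ x)) _ ⟩
      count (λ z → does (a ≟ z)) (x ∷ xs) ∎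
    where
      open ≡-Reasoning
      P : Vec A (suc k) → Bool
      P v = does (Vec.≡-dec _≟_ (a ∷ w) v)

allVecs : List A → (k : ℕ) → List (Vec A k)
allVecs xs zero = [] ∷ []
allVecs xs (suc k) = cartesianProductWith _∷_ xs (allVecs xs k)

length-cartesianProductWith : {C : Set} (f : A → B → C) (xs : List A) (ys : List B) →
  length (cartesianProductWith f xs ys) ≡ length xs * length ys
length-cartesianProductWith f [] ys = refl
length-cartesianProductWith f (x ∷ xs) ys = trans (length-++ (map (f x) ys))
  (cong₂ _+_ (length-map (f x) ys) (length-cartesianProductWith f xs ys))

length-allVecs : (xs : List A) (k : ℕ) → length (allVecs xs k) ≡ length xs ^ k
length-allVecs xs zero = refl
length-allVecs xs (suc k) =
  trans (length-cartesianProductWith _∷_ xs (allVecs xs k)) (cong (length xs *_) (length-allVecs xs k))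

enumerates-allVecs : (_≟_ : DecidableEquality A) {xs : List A} → Enumerates _≟_ xs →
  (k : ℕ) → Enumerates (Vec.≡-dec _≟_) (allVecs xs k)
enumerates-allVecs _≟_ xs-enum zero [] = refl
enumerates-allVecs _≟_ {xs} xs-enum (suc k) (a ∷ w) =
  trans (count-cartesianProduct-∷ _≟_ (enumerates-allVecs _≟_ xs-enum k) a w xs) (xs-enum a)

_≟ᵇ_ : DecidableEquality (Bool × Bool)
_≟ᵇ_ = Product.≡-dec Bool._≟_ Bool._≟_

boolPairs : List (Bool × Bool)
boolPairs = (true , true) ∷ (true , false) ∷ (false , true) ∷ (false , false) ∷ []

enumerates-boolPairs : Enumerates _≟ᵇ_ boolPairs
enumerates-boolPairs (true , true) = refl
enumerates-boolPairs (true , false) = refl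
enumerates-boolPairs (false , true) = refl
enumerates-boolPairs (false , false) = refl

module _ {n : ℕ} where

  ⊕-diagonal : (G : Adj n) (F : Flip n) (u : Fin n) → (G ⊕ F) u u ≡ G u u
  ⊕-diagonal G F u with u Fin.≟ u
  ... | yes _ = refl
  ... | no u≢u = contradiction refl u≢u

  ⊕-offDiagonal : (G : Adj n) (F : Flip n) (u v : Fin n) → ¬ u ≡ v → (G ⊕ F) u v ≡ G u v xor flipsPair F u v
  ⊕-offDiagonal G F u v u≢v with u Fin.≟ v
  ... | yes u≡v = contradiction u≡v u≢v
  ... | no _ = refl

  odd-countFlipping-∷ : (F : Flip n) (Fs : List (Flip n)) (u v : Fin n) →
    odd (countFlipping (F ∷ Fs) u v) ≡ flipsPair F u v xor odd (countFlipping Fs u v)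
  odd-countFlipping-∷ F Fs u v with flipsPair F u v
  ... | true = refl
  ... | false = refl

  ⊕*-diagonal : (G : Adj n) (Fs : List (Flip n)) (u : Fin n) → (G ⊕* Fs) u u ≡ G u u
  ⊕*-diagonal G [] u = refl
  ⊕*-diagonal G (F ∷ Fs) u = trans (⊕*-diagonal (G ⊕ F) Fs u) (⊕-diagonal G F u)

  ⊕*-offDiagonal : (G : Adj n) (Fs : List (Flip n)) (u v : Fin n) → ¬ u ≡ v →
    (G ⊕* Fs) u v ≡ G u v xor odd (countFlipping Fs u v)
  ⊕*-offDiagonal G [] u v _ = sym (xor-identityʳ (G u v))
  ⊕*-offDiagonal G (F ∷ Fs) u v u≢v = begin
      ((G ⊕ F) ⊕* Fs) u v
    ≡⟨ ⊕*-offDiagonal (G ⊕ F) Fs u v u≢v ⟩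
      (G ⊕ F) u v xor odd (countFlipping Fs u v)
    ≡⟨ cong (_xor odd (countFlipping Fs u v)) (⊕-offDiagonal G F u v u≢v) ⟩
      (G u v xor flipsPair F u v) xor odd (countFlipping Fs u v)
    ≡⟨ xor-assoc (G u v) (flipsPair F u v) (odd (countFlipping Fs u v)) ⟩
      G u v xor (flipsPair F u v xor odd (countFlipping Fs u v))
    ≡⟨ cong (G u v xor_) (odd-countFlipping-∷ F Fs u v) ⟨
      G u v xor odd (countFlipping (F ∷ Fs) u v) ∎
    where open ≡-Reasoning

  ⊕*-≡-if-same-parity : (G : Adj n) (Fs Fs′ : List (Flip n)) →
    (∀ u v → ¬ u ≡ v → odd (countFlipping Fs u v) ≡ odd (countFlipping Fs′ u v)) →
    ∀ u v → (G ⊕* Fs) u v ≡ (G ⊕* Fs′) u v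
  ⊕*-≡-if-same-parity G Fs Fs′ same u v with u Fin.≟ v
  ... | yes refl = trans (⊕*-diagonal G Fs u) (sym (⊕*-diagonal G Fs′ u))
  ... | no u≢v = begin
      (G ⊕* Fs) u v                        ≡⟨ ⊕*-offDiagonal G Fs u v u≢v ⟩
      G u v xor odd (countFlipping Fs u v)  ≡⟨ cong (G u v xor_) (same u v u≢v) ⟩
      G u v xor odd (countFlipping Fs′ u v) ≡⟨ ⊕*-offDiagonal G Fs′ u v u≢v ⟨
      (G ⊕* Fs′) u v                       ∎
    where open ≡-Reasoning

  countFlipping≡count : (Fs : List (Flip n)) (u v : Fin n) → countFlipping Fs u v ≡ count (λ F → flipsPair F u v) Fs
  countFlipping≡count [] u v = refl
  countFlipping≡count (F ∷ Fs) u v = if-suc-cong (flipsPair F u v) (countFlipping≡count Fs u v)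

  FlipsDistinctPair : Flip n → Set
  FlipsDistinctPair F = ∃ λ u → ∃ λ v → ¬ u ≡ v × flipsPair F u v ≡ true

  flipsDistinctPair? : Decidable FlipsDistinctPair
  flipsDistinctPair? F = any? λ u → any? λ v → ¬? (u Fin.≟ v) ×-dec (flipsPair F u v Bool.≟ true)

  unique-if-flipped-at-most-once : (Fs : List (Flip n)) → All FlipsDistinctPair Fs →
    (∀ u v → ¬ u ≡ v → count (λ F → flipsPair F u v) Fs ≤ 1) → Unique Fs
  unique-if-flipped-at-most-once [] [] _ = []
  unique-if-flipped-at-most-once (F ∷ Fs) ((u , v , u≢v , F-flips) ∷ nontrivial) atMostOnce =
    All.tabulate F∉Fs ∷ unique-if-flipped-at-most-once Fs nontrivial
      (λ u′ v′ u′≢v′ → ≤-trans (count-≤-∷ (λ F′ → flipsPair F′ u′ v′) F Fs) (atMostOnce u′ v′ u′≢v′))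
    where
      notFlippedAgain : All (λ F′ → flipsPair F′ u v ≡ false) Fs
      notFlippedAgain = count≤1-∷-none (λ F′ → flipsPair F′ u v) {F} Fs F-flips (atMostOnce u v u≢v)
      F∉Fs : ∀ {F′} → F′ ∈ Fs → ¬ F ≡ F′
      F∉Fs F′∈Fs refl with () ← trans (sym F-flips) (All.lookup notFlippedAgain F′∈Fs)

VertexType : ℕ → Set
VertexType k = Vec (Bool × Bool) k

_≟ᵗ_ : {k : ℕ} → DecidableEquality (VertexType k)
_≟ᵗ_ = Vec.≡-dec _≟ᵇ_

crosses : Bool × Bool → Bool × Bool → Bool
crosses (a₁ , b₁) (a₂ , b₂) = (a₁ ∧ b₂) ∨ (b₁ ∧ a₂)

crosses-comm : (p q : Bool × Bool) → crosses p q ≡ crosses q p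
crosses-comm (a₁ , b₁) (a₂ , b₂) = ∧-∨-reverse a₁ b₂ b₁ a₂

crossParity : {k : ℕ} → VertexType k → VertexType k → Bool
crossParity [] [] = false
crossParity (p ∷ s) (q ∷ t) = crosses p q xor crossParity s t

crossParity-comm : {k : ℕ} (s t : VertexType k) → crossParity s t ≡ crossParity t s
crossParity-comm [] [] = refl
crossParity-comm (p ∷ s) (q ∷ t) = cong₂ _xor_ (crosses-comm p q) (crossParity-comm s t)

module _ {n : ℕ} where

  vertexType : (Fs : List (Flip n)) → Fin n → VertexType (length Fs)
  vertexType [] u = []
  vertexType ((A , B) ∷ Fs) u = (lookup A u , lookup B u) ∷ vertexType Fs u

  odd-countFlipping≡crossParity : (Fs : List (Flip n)) (u v : Fin n) →
    odd (countFlipping Fs u v) ≡ crossParity (vertexType Fs u) (vertexType Fs v)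
  odd-countFlipping≡crossParity [] u v = refl
  odd-countFlipping≡crossParity (F ∷ Fs) u v =
    trans (odd-countFlipping-∷ F Fs u v) (cong (flipsPair F u v xor_) (odd-countFlipping≡crossParity Fs u v))

module TypeClassFlips {n : ℕ} (𝓕 : List (Flip n)) where

  τ : Fin n → VertexType (length 𝓕)
  τ = vertexType 𝓕

  hasType : Fin n → VertexType (length 𝓕) → Bool
  hasType u s = does (τ u ≟ᵗ s)

  typeClass : VertexType (length 𝓕) → Subset n
  typeClass s = tabulate (λ u → hasType u s)

  classFlip : VertexType (length 𝓕) × VertexType (length 𝓕) → Flip n
  classFlip (s , t) = typeClass s , typeClass t

  flipsPair-classFlip : (p : VertexType (length 𝓕) × VertexType (length 𝓕)) (u v : Fin n) →
    flipsPair (classFlip p) u v ≡ joins (hasType u) (hasType v) p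
  flipsPair-classFlip (s , t) u v
    rewrite Vec.lookup∘tabulate (λ w → hasType w s) u | Vec.lookup∘tabulate (λ w → hasType w t) v
          | Vec.lookup∘tabulate (λ w → hasType w t) u | Vec.lookup∘tabulate (λ w → hasType w s) v = refl

  crossParity-if-joins : (u v : Fin n) (p : VertexType (length 𝓕) × VertexType (length 𝓕)) →
    joins (hasType u) (hasType v) p ≡ true → uncurry crossParity p ≡ crossParity (τ u) (τ v)
  crossParity-if-joins u v (s , t) joined with joins-≟-sound _≟ᵗ_ (τ u) (τ v) s t joined
  ... | inj₁ (refl , refl) = refl
  ... | inj₂ (refl , refl) = crossParity-comm s t

  allTypes : List (VertexType (length 𝓕))
  allTypes = allVecs boolPairs (length 𝓕)

  oddPairs : List (VertexType (length 𝓕) × VertexType (length 𝓕))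
  oddPairs = filterᵇ (uncurry crossParity) (unorderedPairs allTypes)

  typeFlips : List (Flip n)
  typeFlips = map classFlip oddPairs

  count-typeFlips : (u v : Fin n) →
    count (λ F → flipsPair F u v) typeFlips ≡ (if crossParity (τ u) (τ v) then 1 else 0)
  count-typeFlips u v = begin
      count (λ F → flipsPair F u v) (map classFlip oddPairs)
    ≡⟨ count-map (λ F → flipsPair F u v) classFlip oddPairs ⟩
      count (λ p → flipsPair (classFlip p) u v) oddPairs
    ≡⟨ count-filter (T? ∘ uncurry crossParity) (λ p → flipsPair (classFlip p) u v) (unorderedPairs allTypes) ⟩
      count (λ p → uncurry crossParity p ∧ flipsPair (classFlip p) u v) (unorderedPairs allTypes)
    ≡⟨ count-cong (λ p → trans (cong (uncurry crossParity p ∧_) (flipsPair-classFlip p u v))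
                                (∧-congˡ-if (joins uType vType p) (crossParity-if-joins u v p)))
                  (unorderedPairs allTypes) ⟩
      count (λ p → crossParity (τ u) (τ v) ∧ joins uType vType p) (unorderedPairs allTypes)
    ≡⟨ count-∧ˡ (crossParity (τ u) (τ v)) (joins uType vType) (unorderedPairs allTypes) ⟩
      (if crossParity (τ u) (τ v) then count (joins uType vType) (unorderedPairs allTypes) else 0)
    ≡⟨ cong (λ m → if crossParity (τ u) (τ v) then m else 0)
            (count-joins-unorderedPairs uType vType allTypes (enumerates-allTypes (τ u)) (enumerates-allTypes (τ v))) ⟩
      (if crossParity (τ u) (τ v) then 1 else 0) ∎
    where
      open ≡-Reasoning
      uType = hasType u
      vType = hasType v
      enumerates-allTypes : Enumerates _≟ᵗ_ allTypes
      enumerates-allTypes = enumerates-allVecs _≟ᵇ_ enumerates-boolPairs (length 𝓕)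

  flips : List (Flip n)
  flips = filter flipsDistinctPair? typeFlips

  count-flips : (u v : Fin n) → ¬ u ≡ v →
    count (λ F → flipsPair F u v) flips ≡ (if crossParity (τ u) (τ v) then 1 else 0)
  count-flips u v u≢v = begin
      count (λ F → flipsPair F u v) (filter flipsDistinctPair? typeFlips)
    ≡⟨ count-filter flipsDistinctPair? (λ F → flipsPair F u v) typeFlips ⟩
      count (λ F → does (flipsDistinctPair? F) ∧ flipsPair F u v) typeFlips
    ≡⟨ count-cong (λ F → ∧-congˡ-if (flipsPair F u v) (λ F-flips → dec-true (flipsDistinctPair? F) (u , v , u≢v , F-flips)))
                  typeFlips ⟩
      count (λ F → flipsPair F u v) typeFlips
    ≡⟨ count-typeFlips u v ⟩
      (if crossParity (τ u) (τ v) then 1 else 0) ∎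
    where open ≡-Reasoning

  flips-flip-at-most-once : (u v : Fin n) → ¬ u ≡ v → count (λ F → flipsPair F u v) flips ≤ 1
  flips-flip-at-most-once u v u≢v = subst (_≤ 1) (sym (count-flips u v u≢v)) (indicator≤1 _)

  odd-countFlipping-flips : (u v : Fin n) → ¬ u ≡ v → odd (countFlipping 𝓕 u v) ≡ odd (countFlipping flips u v)
  odd-countFlipping-flips u v u≢v = begin
      odd (countFlipping 𝓕 u v)                       ≡⟨ odd-countFlipping≡crossParity 𝓕 u v ⟩
      crossParity (τ u) (τ v)                          ≡⟨ odd-indicator (crossParity (τ u) (τ v)) ⟨
      odd (if crossParity (τ u) (τ v) then 1 else 0)   ≡⟨ cong odd (count-flips u v u≢v) ⟨
      odd (count (λ F → flipsPair F u v) flips)        ≡⟨ cong odd (countFlipping≡count flips u v) ⟨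
      odd (countFlipping flips u v)                    ∎
    where open ≡-Reasoning

  length-flips : length flips ≤ (2 ^ (2 * length 𝓕) + 1) C 2
  length-flips = begin
      length (filter flipsDistinctPair? typeFlips)  ≤⟨ length-filter flipsDistinctPair? typeFlips ⟩
      length (map classFlip oddPairs)               ≡⟨ length-map classFlip oddPairs ⟩
      length oddPairs                               ≤⟨ length-filter (T? ∘ uncurry crossParity) (unorderedPairs allTypes) ⟩
      length (unorderedPairs allTypes)              ≡⟨ length-unorderedPairs allTypes ⟩
      suc (length allTypes) C 2                     ≡⟨ cong (λ m → suc m C 2) (length-allVecs boolPairs (length 𝓕)) ⟩
      suc (4 ^ length 𝓕) C 2                        ≡⟨ cong (λ m → suc m C 2) (^-*-assoc 2 2 (length 𝓕)) ⟩
      suc (2 ^ (2 * length 𝓕)) C 2                  ≡⟨ cong (_C 2) (+-comm 1 (2 ^ (2 * length 𝓕))) ⟩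
      (2 ^ (2 * length 𝓕) + 1) C 2                  ∎
    where open ≤-Reasoning

mainTheorem2 : (n k : ℕ) (G : Adj n) → IsGraph G →
    (𝓕 : List (Flip n)) → Unique 𝓕 → length 𝓕 ≡ k →
    Σ (List (Flip n)) (λ 𝓕′ →
      Unique 𝓕′ ×
      (∀ u v → (G ⊕* 𝓕) u v ≡ (G ⊕* 𝓕′) u v) ×
      length 𝓕′ ≤ (2 ^ (2 * k) + 1) C 2 ×
      (∀ u v → ¬ (u ≡ v) → countFlipping 𝓕′ u v ≤ 1))
mainTheorem2 n .(length 𝓕) G _ 𝓕 _ refl =
    flips
  , unique-if-flipped-at-most-once flips (all-filter flipsDistinctPair? typeFlips) flips-flip-at-most-once
  , ⊕*-≡-if-same-parity G 𝓕 flips odd-countFlipping-flips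
  , length-flips
  , λ u v u≢v → subst (_≤ 1) (sym (countFlipping≡count flips u v)) (flips-flip-at-most-once u v u≢v)
  where open TypeClassFlips 𝓕
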